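{- For a graph $G$, $\gamma_{(2,1,0)}(G)=3$ if and only if $\gamma_{\times2}(G)=\gamma(G)+1=3$.
   Context: All graphs are finite and simple; $N(v)$ is the open neighbourhood, $N[v]=N(v)\cup\{v\}$, and $f(S)=\sum_{u\in S}f(u)$. $\gamma_{(2,1,0)}(G)$ is the minimum of $\sum_v f(v)$ over functions $f:V(G)\to\{0,1,2\}$ such that $f(N(v))\ge2$ whenever $f(v)=0$ and $f(N(v))\ge1$ whenever $f(v)=1$. $\gamma(G)$ is the domination number; $\gamma_{\times2}(G)$ is the double domination number (minimum size of a set $D$ with $|N[v]\cap D|\ge2$ for every vertex $v$), defined for graphs with no isolated vertex. -}

module Defs where

open import Data.Nat using (ℕ; zero; suc; _+_; _≤_)
open import Data.Fin using (Fin; toℕ)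
open import Data.List using (List; map; allFin)
open import Data.Nat.ListAction using (sum)
open import Data.Bool using (Bool; true; false; if_then_else_)
open import Data.Product using (Σ; ∃; _×_; _,_)
open import Data.Empty using (⊥)
open import Relation.Nullary using (¬_; Dec; does)
open import Relation.Binary.PropositionalEquality using (_≡_)

record Graph : Set₁ where
  field
    n     : ℕ
    Adj   : Fin n → Fin n → Set
    adj?  : (u v : Fin n) → Dec (Adj u v)
    sym   : ∀ {u v} → Adj u v → Adj v u
    irrefl : ∀ {u} → ¬ Adj u u
open Graph public

total : (G : Graph) → (Fin (n G) → ℕ) → ℕ
total G w = sum (map w (allFin (n G)))

nsum : (G : Graph) → (Fin (n G) → ℕ) → Fin (n G) → ℕ
nsum G w v = sum (map (λ u → if does (adj? G v u) then w u else 0) (allFin (n G)))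

csum : (G : Graph) → (Fin (n G) → ℕ) → Fin (n G) → ℕ
csum G w v = w v + nsum G w v

VSet : Graph → Set
VSet G = Fin (n G) → Bool

ind : (G : Graph) → VSet G → Fin (n G) → ℕ
ind G D u = if D u then 1 else 0

card : (G : Graph) → VSet G → ℕ
card G D = total G (ind G D)

IsDominating : (G : Graph) → VSet G → Set
IsDominating G D = ∀ v → 1 ≤ csum G (ind G D) v

IsDoubleDominating : (G : Graph) → VSet G → Set
IsDoubleDominating G D = ∀ v → 2 ≤ csum G (ind G D) v

Is210Function : (G : Graph) → (Fin (n G) → Fin 3) → Set
Is210Function G f =
  ∀ v → (toℕ (f v) ≡ 0 → 2 ≤ nsum G (λ u → toℕ (f u)) v)
      × (toℕ (f v) ≡ 1 → 1 ≤ nsum G (λ u → toℕ (f u)) v)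

γ≡ : Graph → ℕ → Set
γ≡ G k = (Σ (VSet G) λ D → IsDominating G D × card G D ≡ k)
       × (∀ D → IsDominating G D → k ≤ card G D)

γ×2≡ : Graph → ℕ → Set
γ×2≡ G k = (Σ (VSet G) λ D → IsDoubleDominating G D × card G D ≡ k)
         × (∀ D → IsDoubleDominating G D → k ≤ card G D)

γ210≡ : Graph → ℕ → Set
γ210≡ G k =
  (Σ (Fin (n G) → Fin 3) λ f → Is210Function G f × total G (λ u → toℕ (f u)) ≡ k)
  × (∀ f → Is210Function G f → k ≤ total G (λ u → toℕ (f u)))

NoIsolated : Graph → Set
NoIsolated G = ∀ v → ∃ λ u → Adj G v u

-- A dominating set D yields the (2,1,0)-function 2·1_D and a double dominating set D yields
-- 1_D, so γ₍₂,₁,₀₎ ≤ min (2γ) γ×2.  Conversely, the support of a (2,1,0)-function f is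
-- dominating, and it is smaller than the weight of f if f takes the value 2, and double
-- dominating of the same size otherwise; so γ₍₂,₁,₀₎ ≥ min γ×2 (γ + 1).  If γ₍₂,₁,₀₎ = 3 then
-- γ ≥ 2, so an optimal f never takes the value 2 (a vertex of value 2 would dominate the graph
-- on its own, as every closed neighbourhood carries weight ≥ 2); hence γ×2 = 3, and deleting a
-- vertex from a minimum double dominating set leaves a dominating set of size 2.
module Submission where

open import Defs hiding (sym)
open import Data.Bool using (true; false; if_then_else_)
open import Data.Fin using (Fin; zero; suc; toℕ)
open import Data.Fin.Properties using (_≟_; any?; toℕ≤pred[n])
open import Data.List using (map; allFin; tabulate)
open import Data.List.Properties using (map-tabulate)
import Data.Nat.ListAction as ListAction
open import Data.Nat using (ℕ; zero; suc; _+_; _≤_; _<_; _<ᵇ_; z≤n; s≤s; s≤s⁻¹)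
open import Data.Nat.Properties
  using ( +-0-commutativeMonoid; +-commutativeSemigroup; +-mono-≤; +-monoˡ-≤; +-identityʳ; n<1+n; m≤n+m
        ; ≤-refl; ≤-reflexive; ≤-trans; <⇒≤; ≤⇒≯; ≮⇒≥; ≰⇒>; <-irrefl; suc-injective
        ; _≤?_; _<?_; module ≤-Reasoning)
open import Algebra.Properties.CommutativeMonoid.Sum +-0-commutativeMonoid
  using (∑-distrib-+; sum-cong-≗; sum-replicate-zero) renaming (sum to ∑)
open import Algebra.Properties.CommutativeSemigroup +-commutativeSemigroup using (interchange)
open import Data.Product using (∃; _×_; _,_; proj₁; proj₂)
open import Data.Sum using (_⊎_; inj₁; inj₂)
open import Function using (_∘_; id)
open import Function.Bundles using (_⇔_; mk⇔)
open import Relation.Nullary using (¬_; yes; no; does; contradiction)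
open import Relation.Nullary.Decidable using (dec-true; dec-false)
open import Relation.Binary.PropositionalEquality
  using (_≡_; _≢_; _≗_; refl; sym; trans; cong; cong₂; subst; module ≡-Reasoning)

m+m<n+n⇒m<n : ∀ {m n} → m + m < n + n → m < n
m+m<n+n⇒m<n {m} {n} lt with m <? n
... | yes m<n = m<n
... | no m≮n = contradiction lt (≤⇒≯ (+-mono-≤ (≮⇒≥ m≮n) (≮⇒≥ m≮n)))

δ : ∀ {n} → Fin n → ℕ → Fin n → ℕ
δ i c j = if does (j ≟ i) then c else 0

∑-mono : ∀ {n} {w w′ : Fin n → ℕ} → (∀ i → w i ≤ w′ i) → ∑ w ≤ ∑ w′
∑-mono {zero}  _  = z≤n
∑-mono {suc n} le = +-mono-≤ (le zero) (∑-mono (le ∘ suc))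

∑-δ : ∀ {n} (i : Fin n) c → ∑ (δ i c) ≡ c
∑-δ {suc n} zero    c = trans (cong (c +_) (sum-replicate-zero n)) (+-identityʳ c)
∑-δ {suc n} (suc i) c = ∑-δ i c

∑-pos : ∀ {n} (w : Fin n → ℕ) → 0 < ∑ w → ∃ λ i → 0 < w i
∑-pos {suc n} w p with w zero in eq
... | suc _ = zero , subst (0 <_) (sym eq) (s≤s z≤n)
... | zero  with ∑-pos (w ∘ suc) p
...   | i , q = suc i , q

sum-map-allFin : ∀ {n} (w : Fin n → ℕ) → ListAction.sum (map w (allFin n)) ≡ ∑ w
sum-map-allFin w = trans (cong ListAction.sum (map-tabulate id w)) (sum-tabulate w)
  where
  sum-tabulate : ∀ {n} (w : Fin n → ℕ) → ListAction.sum (tabulate w) ≡ ∑ w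
  sum-tabulate {zero}  w = refl
  sum-tabulate {suc n} w = cong (w zero +_) (sum-tabulate (w ∘ suc))

atMostOne⊎heavy : ∀ {n} (w : Fin n → ℕ) → (∀ i → w i ≤ 1) ⊎ ∃ λ i → 2 ≤ w i
atMostOne⊎heavy w with any? (λ i → 2 ≤? w i)
... | yes heavy = inj₂ heavy
... | no ¬heavy = inj₁ λ i → s≤s⁻¹ (≰⇒> λ h → ¬heavy (i , h))

module Domination (G : Graph) where

  V : Set
  V = Fin (n G)

  onNeighbours : (V → ℕ) → V → V → ℕ
  onNeighbours w v u = if does (adj? G v u) then w u else 0

  total-∑ : ∀ w → total G w ≡ ∑ w
  total-∑ = sum-map-allFin

  nsum-∑ : ∀ w v → nsum G w v ≡ ∑ (onNeighbours w v)
  nsum-∑ w v = sum-map-allFin (onNeighbours w v)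

  total-mono : ∀ {w w′} → (∀ u → w u ≤ w′ u) → total G w ≤ total G w′
  total-mono {w} {w′} le rewrite total-∑ w | total-∑ w′ = ∑-mono le

  total-cong : ∀ {w w′} → w ≗ w′ → total G w ≡ total G w′
  total-cong {w} {w′} eq rewrite total-∑ w | total-∑ w′ = sum-cong-≗ eq

  total-+ : ∀ w w′ → total G (λ u → w u + w′ u) ≡ total G w + total G w′
  total-+ w w′ rewrite total-∑ (λ u → w u + w′ u) | total-∑ w | total-∑ w′ = ∑-distrib-+ w w′

  total-δ : ∀ a c → total G (δ a c) ≡ c
  total-δ a c = trans (total-∑ (δ a c)) (∑-δ a c)

  nsum-mono : ∀ {w w′} v → (∀ u → w u ≤ w′ u) → nsum G w v ≤ nsum G w′ v
  nsum-mono {w} {w′} v le rewrite nsum-∑ w v | nsum-∑ w′ v = ∑-mono masked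
    where
    masked : ∀ u → onNeighbours w v u ≤ onNeighbours w′ v u
    masked u with does (adj? G v u)
    ... | true  = le u
    ... | false = z≤n

  nsum-cong : ∀ {w w′} v → w ≗ w′ → nsum G w v ≡ nsum G w′ v
  nsum-cong {w} {w′} v eq rewrite nsum-∑ w v | nsum-∑ w′ v = sum-cong-≗ masked
    where
    masked : onNeighbours w v ≗ onNeighbours w′ v
    masked u with does (adj? G v u)
    ... | true  = eq u
    ... | false = refl

  nsum-+ : ∀ w w′ v → nsum G (λ u → w u + w′ u) v ≡ nsum G w v + nsum G w′ v
  nsum-+ w w′ v = begin
    nsum G (λ u → w u + w′ u) v                                      ≡⟨ nsum-∑ _ v ⟩
    ∑ (onNeighbours (λ u → w u + w′ u) v)                            ≡⟨ sum-cong-≗ masked ⟩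
    ∑ (λ u → onNeighbours w v u + onNeighbours w′ v u)               ≡⟨ ∑-distrib-+ (onNeighbours w v) (onNeighbours w′ v) ⟩
    ∑ (onNeighbours w v) + ∑ (onNeighbours w′ v)                     ≡⟨ sym (cong₂ _+_ (nsum-∑ w v) (nsum-∑ w′ v)) ⟩
    nsum G w v + nsum G w′ v                                         ∎
    where
    open ≡-Reasoning
    masked : ∀ u → onNeighbours (λ u → w u + w′ u) v u ≡ onNeighbours w v u + onNeighbours w′ v u
    masked u with does (adj? G v u)
    ... | true  = refl
    ... | false = refl

  nsum-δ : ∀ a c v → nsum G (δ a c) v ≡ (if does (adj? G v a) then c else 0)
  nsum-δ a c v = trans (nsum-∑ (δ a c) v) (trans (sum-cong-≗ concentrated) (∑-δ a _))
    where
    concentrated : ∀ u → onNeighbours (δ a c) v u ≡ δ a (if does (adj? G v a) then c else 0) u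
    concentrated u with u ≟ a
    ... | yes refl = refl
    ... | no _ with does (adj? G v u)
    ...   | true  = refl
    ...   | false = refl

  csum-cong : ∀ {w w′} v → w ≗ w′ → csum G w v ≡ csum G w′ v
  csum-cong v eq = cong₂ _+_ (eq v) (nsum-cong v eq)

  csum-mono : ∀ {w w′} v → (∀ u → w u ≤ w′ u) → csum G w v ≤ csum G w′ v
  csum-mono v le = +-mono-≤ (le v) (nsum-mono v le)

  csum-+ : ∀ w w′ v → csum G (λ u → w u + w′ u) v ≡ csum G w v + csum G w′ v
  csum-+ w w′ v = begin
    w v + w′ v + nsum G (λ u → w u + w′ u) v       ≡⟨ cong (w v + w′ v +_) (nsum-+ w w′ v) ⟩
    w v + w′ v + (nsum G w v + nsum G w′ v)        ≡⟨ interchange (w v) (w′ v) _ _ ⟩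
    w v + nsum G w v + (w′ v + nsum G w′ v)        ∎
    where open ≡-Reasoning

  csum-δ≤ : ∀ a c v → csum G (δ a c) v ≤ c
  csum-δ≤ a c v rewrite nsum-δ a c v with v ≟ a
  ... | yes refl rewrite dec-false (adj? G v v) (irrefl G) = ≤-reflexive (+-identityʳ c)
  ... | no _ with does (adj? G v a)
  ...   | true  = ≤-refl
  ...   | false = z≤n

  csum+outside≤total : ∀ w {v a} → v ≢ a → ¬ Adj G v a → csum G w v + w a ≤ total G w
  csum+outside≤total w {v} {a} v≢a ¬adj = begin
    csum G w v + w a
      ≡⟨ cong₂ _+_ (cong₂ _+_ (sym (∑-δ v (w v))) (nsum-∑ w v)) (sym (∑-δ a (w a))) ⟩
    ∑ (δ v (w v)) + ∑ (onNeighbours w v) + ∑ (δ a (w a))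
      ≡⟨ cong (_+ ∑ (δ a (w a))) (∑-distrib-+ (δ v (w v)) (onNeighbours w v)) ⟨
    ∑ (λ u → δ v (w v) u + onNeighbours w v u) + ∑ (δ a (w a))
      ≡⟨ ∑-distrib-+ (λ u → δ v (w v) u + onNeighbours w v u) (δ a (w a)) ⟨
    ∑ (λ u → δ v (w v) u + onNeighbours w v u + δ a (w a) u)
      ≤⟨ ∑-mono disjoint ⟩
    ∑ w
      ≡⟨ total-∑ w ⟨
    total G w
      ∎
    where
    open ≤-Reasoning
    disjoint : ∀ u → δ v (w v) u + onNeighbours w v u + δ a (w a) u ≤ w u
    disjoint u with u ≟ v | u ≟ a
    ... | yes refl | yes refl = contradiction refl v≢a
    ... | yes refl | no _ rewrite dec-false (adj? G u u) (irrefl G) =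
      ≤-reflexive (trans (+-identityʳ _) (+-identityʳ _))
    ... | no _ | yes refl rewrite dec-false (adj? G v u) ¬adj = ≤-refl
    ... | no _ | no _ with does (adj? G v u)
    ...   | true  = ≤-reflexive (+-identityʳ _)
    ...   | false = z≤n

  ⁅_⁆ : V → VSet G
  ⁅ a ⁆ u = does (u ≟ a)

  card-⁅⁆ : ∀ a → card G ⁅ a ⁆ ≡ 1
  card-⁅⁆ a = total-δ a 1

  ⁅⁆-dominating : ∀ {a} → (∀ v → v ≡ a ⊎ Adj G v a) → IsDominating G ⁅ a ⁆
  ⁅⁆-dominating {a} covered v with covered v
  ... | inj₁ refl rewrite dec-true (v ≟ v) refl = s≤s z≤n
  ... | inj₂ adj  rewrite nsum-δ a 1 v | dec-true (adj? G v a) adj = m≤n+m 1 _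

  card-pos : ∀ D → 0 < card G D → ∃ λ x → D x ≡ true
  card-pos D p with ∑-pos (ind G D) (subst (0 <_) (total-∑ (ind G D)) p)
  ... | x , q with D x in Dx
  ...   | true = x , Dx

  _∖_ : VSet G → V → VSet G
  (D ∖ x) u = if does (u ≟ x) then false else D u

  ind-∖ : ∀ D {x} → D x ≡ true → ind G D ≗ λ u → δ x 1 u + ind G (D ∖ x) u
  ind-∖ D {x} Dx u with u ≟ x
  ... | yes refl rewrite Dx = refl
  ... | no _ = refl

  card-∖ : ∀ D {x} → D x ≡ true → card G D ≡ suc (card G (D ∖ x))
  card-∖ D {x} Dx = trans (total-cong (ind-∖ D Dx))
    (trans (total-+ (δ x 1) (ind G (D ∖ x))) (cong (_+ card G (D ∖ x)) (total-δ x 1)))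

  ∖-dominating : ∀ D {x} → IsDoubleDominating G D → D x ≡ true → IsDominating G (D ∖ x)
  ∖-dominating D {x} dd Dx v = s≤s⁻¹ (begin
    2                                             ≤⟨ dd v ⟩
    csum G (ind G D) v                            ≡⟨ csum-cong v (ind-∖ D Dx) ⟩
    csum G (λ u → δ x 1 u + ind G (D ∖ x) u) v    ≡⟨ csum-+ (δ x 1) (ind G (D ∖ x)) v ⟩
    csum G (δ x 1) v + csum G (ind G (D ∖ x)) v   ≤⟨ +-monoˡ-≤ _ (csum-δ≤ x 1 v) ⟩
    1 + csum G (ind G (D ∖ x)) v                  ∎)
    where open ≤-Reasoning

  ind≤1 : ∀ D u → ind G D u ≤ 1
  ind≤1 D u with D u
  ... | true  = ≤-refl
  ... | false = z≤n

  support : (V → ℕ) → VSet G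
  support w u = 0 <ᵇ w u

  ind-support≤ : ∀ w u → ind G (support w) u ≤ w u
  ind-support≤ w u with w u
  ... | zero  = z≤n
  ... | suc _ = s≤s z≤n

  ind-support≡ : ∀ w {u} → w u ≤ 1 → ind G (support w) u ≡ w u
  ind-support≡ w {u} le with w u | le
  ... | zero     | _       = refl
  ... | suc zero | _       = refl
  ... | suc (suc _) | s≤s ()

  card-support : ∀ w → (∀ u → w u ≤ 1) → card G (support w) ≡ total G w
  card-support w light = total-cong (λ u → ind-support≡ w (light u))

  card-support< : ∀ w {a} → 2 ≤ w a → card G (support w) < total G w
  card-support< w {a} heavy = begin-strict
    card G (support w)                                  <⟨ n<1+n _ ⟩
    1 + card G (support w)                              ≡⟨ cong (_+ card G (support w)) (total-δ a 1) ⟨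
    total G (δ a 1) + card G (support w)                ≡⟨ total-+ (δ a 1) (ind G (support w)) ⟨
    total G (λ u → δ a 1 u + ind G (support w) u)       ≤⟨ total-mono charged ⟩
    total G w                                           ∎
    where
    open ≤-Reasoning
    charged : ∀ u → δ a 1 u + ind G (support w) u ≤ w u
    charged u with u ≟ a
    ... | yes refl = ≤-trans (s≤s (ind≤1 (support w) u)) heavy
    ... | no _ = ind-support≤ w u

  support-dominating : ∀ w → (∀ u → w u ≤ 2) → (∀ v → 2 ≤ csum G w v) →
                       IsDominating G (support w)
  support-dominating w ≤2 ≥2 v = m+m<n+n⇒m<n (<⇒≤ (begin
    2                                                              ≤⟨ ≥2 v ⟩
    csum G w v                                                     ≤⟨ csum-mono v doubledSupport ⟩
    csum G (λ u → ind G (support w) u + ind G (support w) u) v     ≡⟨ csum-+ (ind G (support w)) (ind G (support w)) v ⟩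
    csum G (ind G (support w)) v + csum G (ind G (support w)) v    ∎))
    where
    open ≤-Reasoning
    doubledSupport : ∀ u → w u ≤ ind G (support w) u + ind G (support w) u
    doubledSupport u with w u | ≤2 u
    ... | zero           | _ = z≤n
    ... | suc zero       | _ = s≤s z≤n
    ... | suc (suc zero) | _ = ≤-refl
    ... | suc (suc (suc _)) | s≤s (s≤s ())

  support-doubleDominating : ∀ w → (∀ u → w u ≤ 1) → (∀ v → 2 ≤ csum G w v) →
                             IsDoubleDominating G (support w)
  support-doubleDominating w light ≥2 v =
    subst (2 ≤_) (csum-cong v (λ u → sym (ind-support≡ w (light u)))) (≥2 v)

  -- A vertex v outside N[a] would carry weight 2 in N[v], disjoint from the weight 2 at a.
  heavy-dominating : ∀ w {a} → (∀ v → 2 ≤ csum G w v) → total G w ≤ 3 → 2 ≤ w a →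
                     IsDominating G ⁅ a ⁆
  heavy-dominating w {a} ≥2 ≤3 heavy = ⁅⁆-dominating covered
    where
    covered : ∀ v → v ≡ a ⊎ Adj G v a
    covered v with v ≟ a | adj? G v a
    ... | yes v≡a | _       = inj₁ v≡a
    ... | no _    | yes adj = inj₂ adj
    ... | no v≢a  | no ¬adj = contradiction
      (≤-trans (+-mono-≤ (≥2 v) heavy) (≤-trans (csum+outside≤total w v≢a ¬adj) ≤3)) (<-irrefl refl)

  csum≥2 : ∀ {f} → Is210Function G f → ∀ v → 2 ≤ csum G (toℕ ∘ f) v
  csum≥2 {f} f-210 v with f v in fv
  ... | zero           = proj₁ (f-210 v) (cong toℕ fv)
  ... | suc zero       = s≤s (proj₂ (f-210 v) (cong toℕ fv))
  ... | suc (suc zero) = s≤s (s≤s z≤n)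

  oneOn : VSet G → V → Fin 3
  oneOn D u = if D u then suc zero else zero

  toℕ-oneOn : ∀ D → toℕ ∘ oneOn D ≗ ind G D
  toℕ-oneOn D u with D u
  ... | true  = refl
  ... | false = refl

  total-oneOn : ∀ D → total G (toℕ ∘ oneOn D) ≡ card G D
  total-oneOn D = total-cong (toℕ-oneOn D)

  oneOn-210 : ∀ D → IsDoubleDominating G D → Is210Function G (oneOn D)
  oneOn-210 D dd v rewrite nsum-cong v (toℕ-oneOn D) with D v | dd v
  ... | false | 2≤nsum   = (λ _ → 2≤nsum) , λ ()
  ... | true  | 2≤1+nsum = (λ ()) , λ _ → s≤s⁻¹ 2≤1+nsum

  twoOn : VSet G → V → Fin 3
  twoOn D u = if D u then suc (suc zero) else zero

  toℕ-twoOn : ∀ D → toℕ ∘ twoOn D ≗ λ u → ind G D u + ind G D u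
  toℕ-twoOn D u with D u
  ... | true  = refl
  ... | false = refl

  total-twoOn : ∀ D → total G (toℕ ∘ twoOn D) ≡ card G D + card G D
  total-twoOn D = trans (total-cong (toℕ-twoOn D)) (total-+ (ind G D) (ind G D))

  twoOn-210 : ∀ D → IsDominating G D → Is210Function G (twoOn D)
  twoOn-210 D dom v
    rewrite nsum-cong v (toℕ-twoOn D) | nsum-+ (ind G D) (ind G D) v with D v | dom v
  ... | false | 1≤nsum = (λ _ → +-mono-≤ 1≤nsum 1≤nsum) , λ ()
  ... | true  | _      = (λ ()) , λ ()

  dominating-bound : ∀ {k} → (∀ f → Is210Function G f → k ≤ total G (toℕ ∘ f)) →
                     ∀ D → IsDominating G D → k ≤ card G D + card G D
  dominating-bound bound D dom = subst (_ ≤_) (total-twoOn D) (bound (twoOn D) (twoOn-210 D dom))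

  doubleDominating-bound : ∀ {k} → (∀ f → Is210Function G f → k ≤ total G (toℕ ∘ f)) →
                           ∀ D → IsDoubleDominating G D → k ≤ card G D
  doubleDominating-bound bound D dd = subst (_ ≤_) (total-oneOn D) (bound (oneOn D) (oneOn-210 D dd))

  light-of-weight≤3 : ∀ {f} → Is210Function G f → total G (toℕ ∘ f) ≤ 3 →
                      (∀ D → IsDominating G D → 2 ≤ card G D) → ∀ u → toℕ (f u) ≤ 1
  light-of-weight≤3 {f} f-210 ≤3 γ≥2 u = s≤s⁻¹ (≰⇒> λ heavy → <-irrefl refl
    (subst (2 ≤_) (card-⁅⁆ u) (γ≥2 ⁅ u ⁆ (heavy-dominating (toℕ ∘ f) (csum≥2 f-210) ≤3 heavy))))

  weight-bound : ∀ {k} → (∀ D → IsDoubleDominating G D → k ≤ card G D) →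
                 (∀ D → IsDominating G D → k ≤ suc (card G D)) →
                 ∀ f → Is210Function G f → k ≤ total G (toℕ ∘ f)
  weight-bound γ×2-bound γ-bound f f-210 with atMostOne⊎heavy (toℕ ∘ f)
  ... | inj₁ light = subst (_ ≤_) (card-support (toℕ ∘ f) light)
    (γ×2-bound _ (support-doubleDominating (toℕ ∘ f) light (csum≥2 f-210)))
  ... | inj₂ (_ , heavy) = ≤-trans (γ-bound _ (support-dominating (toℕ ∘ f) (toℕ≤pred[n] ∘ f) (csum≥2 f-210)))
    (card-support< (toℕ ∘ f) heavy)

  shrink : ∀ D → IsDoubleDominating G D → 0 < card G D →
           ∃ λ D′ → IsDominating G D′ × suc (card G D′) ≡ card G D
  shrink D dd nonempty with card-pos D nonempty
  ... | x , Dx = D ∖ x , ∖-dominating D dd Dx , sym (card-∖ D Dx)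

theorem3p34 : (G : Graph) → NoIsolated G →
    (γ210≡ G 3 ⇔ (γ×2≡ G 3 × γ≡ G 2))
theorem3p34 G _ = mk⇔ forward backward
  where
  open Domination G

  forward : γ210≡ G 3 → γ×2≡ G 3 × γ≡ G 2
  forward ((f , f-210 , weight≡3) , minimal) =
    ((S , S-dd , card-S) , doubleDominating-bound minimal) ,
    γ≡2 (shrink S S-dd (subst (0 <_) (sym card-S) (s≤s z≤n)))
    where
    γ≥2 : ∀ D → IsDominating G D → 2 ≤ card G D
    γ≥2 D dom = m+m<n+n⇒m<n (dominating-bound minimal D dom)
    light : ∀ u → toℕ (f u) ≤ 1
    light = light-of-weight≤3 f-210 (≤-reflexive weight≡3) γ≥2
    S : VSet G
    S = support (toℕ ∘ f)
    S-dd : IsDoubleDominating G S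
    S-dd = support-doubleDominating (toℕ ∘ f) light (csum≥2 f-210)
    card-S : card G S ≡ 3
    card-S = trans (card-support (toℕ ∘ f) light) weight≡3
    γ≡2 : (∃ λ D → IsDominating G D × suc (card G D) ≡ card G S) → γ≡ G 2
    γ≡2 (D , D-dom , card-D) = (D , D-dom , suc-injective (trans card-D card-S)) , γ≥2

  backward : γ×2≡ G 3 × γ≡ G 2 → γ210≡ G 3
  backward (((D , D-dd , card-D) , γ×2≥3) , (_ , γ≥2)) =
    (oneOn D , oneOn-210 D D-dd , trans (total-oneOn D) card-D) ,
    weight-bound γ×2≥3 (λ D′ dom → s≤s (γ≥2 D′ dom))
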